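{- None of the following equations has a solution in positive integers $X,Y$: (1) $X^2=Y^4-8Y^3+12Y^2-6Y+1$; (2) $X^2=Y^6-8Y^3+12Y^2-6Y+1$; (3) $X^2=Y^6-32Y^5+80Y^4-80Y^3+40Y^2-10Y+1$; (4) $X^2=Y^8-32Y^5+80Y^4-80Y^3+40Y^2-10Y+1$; (5) $X^2=Y^{10}-8Y^6+12Y^4-6Y^2+1$; (6) $X^2=Y^{10}-32Y^5+80Y^4-80Y^3+40Y^2-10Y+1$; (7) $X^2=Y^{14}-32Y^{10}+80Y^8-80Y^6+40Y^4-10Y^2+1$; (8) $X^2=Y^{18}-32Y^{10}+80Y^8-80Y^6+40Y^4-10Y^2+1$. -}

module Defs where

open import Data.Nat using (ℕ)
open import Data.Integer using (ℤ; +_; _+_; _-_; _*_; _^_)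

rhs1 rhs2 rhs3 rhs4 rhs5 rhs6 rhs7 rhs8 : ℤ → ℤ
rhs1 Y = Y ^ 4 - + 8 * Y ^ 3 + + 12 * Y ^ 2 - + 6 * Y + + 1
rhs2 Y = Y ^ 6 - + 8 * Y ^ 3 + + 12 * Y ^ 2 - + 6 * Y + + 1
rhs3 Y = Y ^ 6 - + 32 * Y ^ 5 + + 80 * Y ^ 4 - + 80 * Y ^ 3 + + 40 * Y ^ 2 - + 10 * Y + + 1
rhs4 Y = Y ^ 8 - + 32 * Y ^ 5 + + 80 * Y ^ 4 - + 80 * Y ^ 3 + + 40 * Y ^ 2 - + 10 * Y + + 1
rhs5 Y = Y ^ 10 - + 8 * Y ^ 6 + + 12 * Y ^ 4 - + 6 * Y ^ 2 + + 1
rhs6 Y = Y ^ 10 - + 32 * Y ^ 5 + + 80 * Y ^ 4 - + 80 * Y ^ 3 + + 40 * Y ^ 2 - + 10 * Y + + 1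
rhs7 Y = Y ^ 14 - + 32 * Y ^ 10 + + 80 * Y ^ 8 - + 80 * Y ^ 6 + + 40 * Y ^ 4 - + 10 * Y ^ 2 + + 1
rhs8 Y = Y ^ 18 - + 32 * Y ^ 10 + + 80 * Y ^ 8 - + 80 * Y ^ 6 + + 40 * Y ^ 4 - + 10 * Y ^ 2 + + 1

open import Data.Integer using (_<_)
open import Relation.Binary.PropositionalEquality using (_≡_)
open import Relation.Nullary using (¬_)

NoPositiveSolution : (ℤ → ℤ) → Set
NoPositiveSolution f = ∀ (X Y : ℤ) → + 0 < X → + 0 < Y → ¬ (X ^ 2 ≡ f Y)

-- For each right-hand side f we take an integer polynomial L, the polynomial part of the
-- expansion of √f at infinity (rounded down), and write f = L² + R. For Y ≥ Y₀ both R and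
-- 2L + 1 − R are positive, so L(Y)² < f(Y) < (L(Y) + 1)² and f(Y) is not a square: expanded
-- around Y₀, both polynomials have natural coefficients and a positive constant term.
-- The finitely many Y ≤ Y₀ are settled by computing integer square roots.

module Submission where

open import Defs
open import Data.Bool.Base using (Bool; true; T; _∧_; if_then_else_)
open import Data.Bool.ListAction using (all)
open import Data.Bool.Properties using (T-≡; T-∧)
open import Data.Empty using (⊥)
open import Data.Fin.Base using (zero)
open import Data.Integer.Base using (ℤ; +_; -[1+_]; ∣_∣; 0ℤ; 1ℤ; _+_; _-_; _*_; _^_; _<_; +<+)
import Data.Integer.Properties as ℤ
open import Data.Integer.Solver using (module +-*-Solver)
open import Data.List.Base using (List; []; _∷_; downFrom)
open import Data.List.Membership.Propositional.Properties using (∈-downFrom⁺)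
open import Data.List.Relation.Unary.All using (lookup)
open import Data.List.Relation.Unary.All.Properties using (all⁺)
open import Data.Nat.Base as ℕ using (ℕ; zero; suc; _<ᵇ_; _/_)
import Data.Nat.Properties as ℕ
open import Data.Product.Base using (∃-syntax; _×_; _,_; proj₁; proj₂)
open import Data.Vec.Base using ([]; _∷_)
open import Function.Base using (_∘_)
open import Function.Bundles using (Equivalence)
open import Relation.Binary.PropositionalEquality
open import Relation.Nullary.Decidable using (yes; no)
open +-*-Solver

no-square-strictly-between : ∀ n x → n ℕ.* n ℕ.< x ℕ.* x → x ℕ.* x ℕ.< suc n ℕ.* suc n → ⊥
no-square-strictly-between n x n²<x² x²<[1+n]² with x ℕ.≤? n
... | yes x≤n = ℕ.<⇒≱ n²<x² (ℕ.*-mono-≤ x≤n x≤n)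
... | no  x≰n = ℕ.<⇒≱ x²<[1+n]² (ℕ.*-mono-≤ (ℕ.≰⇒> x≰n) (ℕ.≰⇒> x≰n))

i*i≡+∣i∣*∣i∣ : ∀ i → i * i ≡ + (∣ i ∣ ℕ.* ∣ i ∣)
i*i≡+∣i∣*∣i∣ (+ n)    = ℤ.+◃n≡+n (n ℕ.* n)
i*i≡+∣i∣*∣i∣ -[1+ n ] = refl

BetweenConsecutiveSquares : ℤ → Set
BetweenConsecutiveSquares v = ∃[ l ] l * l < v × v < (l + 1ℤ) * (l + 1ℤ)

i*i<j*j⇒∣i∣*∣i∣<∣j∣*∣j∣ : ∀ i j → i * i < j * j → ∣ i ∣ ℕ.* ∣ i ∣ ℕ.< ∣ j ∣ ℕ.* ∣ j ∣
i*i<j*j⇒∣i∣*∣i∣<∣j∣*∣j∣ i j = ℤ.drop‿+<+ ∘ subst₂ _<_ (i*i≡+∣i∣*∣i∣ i) (i*i≡+∣i∣*∣i∣ j)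

betweenConsecutiveSquares⇒nonSquare : ∀ {v} → BetweenConsecutiveSquares v → ∀ x → x * x ≢ v
betweenConsecutiveSquares⇒nonSquare (l , l²<x² , x²<[l+1]²) x refl =
  no-square-strictly-between ∣ l ∣ ∣ x ∣
    (i*i<j*j⇒∣i∣*∣i∣<∣j∣*∣j∣ l x l²<x²)
    (ℕ.<-≤-trans (i*i<j*j⇒∣i∣*∣i∣<∣j∣*∣j∣ x (l + 1ℤ) x²<[l+1]²) (ℕ.*-mono-≤ ∣l+1∣≤1+∣l∣ ∣l+1∣≤1+∣l∣))
  where
  ∣l+1∣≤1+∣l∣ : ∣ l + 1ℤ ∣ ℕ.≤ suc ∣ l ∣
  ∣l+1∣≤1+∣l∣ = subst (∣ l + 1ℤ ∣ ℕ.≤_) (ℕ.+-comm ∣ l ∣ 1) (ℤ.∣i+j∣≤∣i∣+∣j∣ l 1ℤ)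

i<i+j : ∀ i {j} → 0ℤ < j → i < i + j
i<i+j i {j} 0<j = subst (_< i + j) (ℤ.+-identityʳ i) (ℤ.+-monoʳ-< i 0<j)

betweenConsecutiveSquares-by-remainder : ∀ l r → 0ℤ < r → 0ℤ < + 2 * l + 1ℤ - r →
                                         BetweenConsecutiveSquares (l * l + r)
betweenConsecutiveSquares-by-remainder l r 0<r 0<gap =
  l , i<i+j (l * l) 0<r , subst (l * l + r <_) (square-of-successor l r) (i<i+j (l * l + r) 0<gap)
  where
  square-of-successor : ∀ l r → l * l + r + (+ 2 * l + 1ℤ - r) ≡ (l + 1ℤ) * (l + 1ℤ)
  square-of-successor = solve 2 (λ l r → l :* l :+ r :+ (con (+ 2) :* l :+ con 1ℤ :- r)
                                       := (l :+ con 1ℤ) :* (l :+ con 1ℤ)) refl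

horner : ∀ {n} → List ℕ → Polynomial n → Polynomial n
horner []       X = con 0ℤ
horner (c ∷ cs) X = con (+ c) :+ X :* horner cs X

horner-∷ : ∀ c cs t m → ⟦ horner cs (var zero) ⟧ (+ t ∷ []) ≡ + m →
           ⟦ horner (c ∷ cs) (var zero) ⟧ (+ t ∷ []) ≡ + (c ℕ.+ t ℕ.* m)
horner-∷ c cs t m eq = trans (cong (λ v → + c + + t * v) eq) (cong (λ v → + c + v) (sym (ℤ.pos-* t m)))

horner-natural : ∀ cs t → ∃[ m ] ⟦ horner cs (var zero) ⟧ (+ t ∷ []) ≡ + m
horner-natural []       t = 0 , refl
horner-natural (c ∷ cs) t with m , eq ← horner-natural cs t = _ , horner-∷ c cs t m eq

natural-coefficients⇒positive : ∀ (p : Polynomial 1) c cs .{{_ : ℕ.NonZero c}} →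
                                (∀ T → ⟦ p ⟧↓ (T ∷ []) ≡ ⟦ horner (c ∷ cs) (var zero) ⟧↓ (T ∷ [])) →
                                ∀ t → 0ℤ < ⟦ p ⟧ (+ t ∷ [])
natural-coefficients⇒positive p c cs p↓≡horner↓ t with m , eq ← horner-natural cs t =
  subst (0ℤ <_) (sym (trans p≡horner (horner-∷ c cs t m eq)))
        (+<+ (ℕ.<-≤-trans (ℕ.>-nonZero⁻¹ c) (ℕ.m≤m+n c (t ℕ.* m))))
  where
  p≡horner : ⟦ p ⟧ (+ t ∷ []) ≡ ⟦ horner (c ∷ cs) (var zero) ⟧ (+ t ∷ [])
  p≡horner = prove (+ t ∷ []) p (horner (c ∷ cs) (var zero)) (p↓≡horner↓ (+ t))

-- Newton's iteration for ⌊√m⌋ from an initial guess. Its result is only a candidate that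
-- nonSquareᵇ checks, so nothing about its convergence is needed (the fuel m is ample).
isqrt-from : ℕ → ℕ → ℕ
isqrt-from guess m = descend m (newton (suc guess))
  where
  newton : ℕ → ℕ
  newton zero    = zero
  newton (suc x) = (suc x ℕ.+ m / suc x) / 2
  descend : ℕ → ℕ → ℕ
  descend zero       x = x
  descend (suc fuel) x = if newton x <ᵇ x then descend fuel (newton x) else x

nonSquareᵇ : ℕ → ℤ → Bool
nonSquareᵇ guess (+ suc m) = (n ℕ.* n <ᵇ suc m) ∧ (suc m <ᵇ (n ℕ.+ 1) ℕ.* (n ℕ.+ 1))
  where
  n : ℕ
  n = isqrt-from guess (suc m)
nonSquareᵇ _     _         = true

nonSquareᵇ-sound : ∀ guess v → T (nonSquareᵇ guess v) → ∀ x → 0ℤ < x → x * x ≢ v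
nonSquareᵇ-sound guess (+ suc m) ok x _ =
  betweenConsecutiveSquares⇒nonSquare (+ n , n²<m , m<[n+1]²) x
  where
  n : ℕ
  n = isqrt-from guess (suc m)
  n²<m : + n * + n < + suc m
  n²<m = subst (_< + suc m) (ℤ.pos-* n n) (+<+ (ℕ.<ᵇ⇒< _ _ (proj₁ (Equivalence.to T-∧ ok))))
  m<[n+1]² : + suc m < (+ n + 1ℤ) * (+ n + 1ℤ)
  m<[n+1]² = subst (+ suc m <_) (ℤ.pos-* (n ℕ.+ 1) (n ℕ.+ 1))
                   (+<+ (ℕ.<ᵇ⇒< _ _ (proj₂ (Equivalence.to T-∧ ok))))
nonSquareᵇ-sound _ (+ zero) _ (+ suc _) _         ()
nonSquareᵇ-sound _ (+ zero) _ (+ zero)  (+<+ ()) _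
nonSquareᵇ-sound _ -[1+ _ ] _ x         _         x²≡v with () ← trans (sym (i*i≡+∣i∣*∣i∣ x)) x²≡v

noPositiveSolution-from-nonSquares : ∀ f → (∀ y x → 0ℤ < x → x * x ≢ f (+ suc y)) →
                                     NoPositiveSolution f
noPositiveSolution-from-nonSquares f nonSquare X (+ suc y) 0<X _        X²≡fY =
  nonSquare y X 0<X (trans (sym (cong (X *_) (ℤ.*-identityʳ X))) X²≡fY)
noPositiveSolution-from-nonSquares f nonSquare X (+ zero)  _   (+<+ ()) _

-- Y = 1, …, Y₀ are checked numerically, with |L(Y)| ≈ √f(Y) as the starting guess.
noPositiveSolution-by-squeeze :
  ∀ (f L R : ℤ → ℤ) Y₀ →
  (∀ Y → f Y ≡ L Y * L Y + R Y) →
  (∀ t → 0ℤ < R (+ Y₀ + + t)) →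
  (∀ t → 0ℤ < + 2 * L (+ Y₀ + + t) + 1ℤ - R (+ Y₀ + + t)) →
  all (λ y → nonSquareᵇ ∣ L (+ suc y) ∣ (f (+ suc y))) (downFrom Y₀) ≡ true →
  NoPositiveSolution f
noPositiveSolution-by-squeeze f L R Y₀ f≡L²+R 0<R 0<gap belowY₀ =
  noPositiveSolution-from-nonSquares f nonSquare
  where
  squeezed : ∀ t → BetweenConsecutiveSquares (f (+ Y₀ + + t))
  squeezed t = subst BetweenConsecutiveSquares (sym (f≡L²+R _))
    (betweenConsecutiveSquares-by-remainder (L (+ Y₀ + + t)) (R (+ Y₀ + + t)) (0<R t) (0<gap t))
  nonSquare : ∀ y x → 0ℤ < x → x * x ≢ f (+ suc y)
  nonSquare y with y ℕ.<? Y₀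
  ... | yes y<Y₀ =
    nonSquareᵇ-sound _ _ (lookup (all⁺ _ _ (Equivalence.from T-≡ belowY₀)) (∈-downFrom⁺ y<Y₀))
  ... | no  y≮Y₀ = λ x _ → subst (λ n → x * x ≢ f (+ n)) (ℕ.m+[n∸m]≡n Y₀≤1+y)
                                 (betweenConsecutiveSquares⇒nonSquare (squeezed (suc y ℕ.∸ Y₀)) x)
    where
    Y₀≤1+y : Y₀ ℕ.≤ suc y
    Y₀≤1+y = ℕ.m≤n⇒m≤1+n (ℕ.≮⇒≥ y≮Y₀)

-- Polynomials are kept as ring-solver expressions, so that the solver can substitute Y₀ + T
-- into them and normalise; ⟦ P ⟧₁ is the integer function P denotes.
PolyExpr : Set
PolyExpr = ∀ {n} → Polynomial n → Polynomial n

⟦_⟧₁ : PolyExpr → ℤ → ℤ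
⟦ P ⟧₁ Y = ⟦ P (var zero) ⟧ (Y ∷ [])

upperGap : PolyExpr → PolyExpr → PolyExpr
upperGap L R Y = con (+ 2) :* L Y :+ con 1ℤ :- R Y

L₁ R₁ : PolyExpr
L₁ Y = Y :^ 2 :- con (+ 4) :* Y :- con (+ 3)
R₁ Y = con (+ 2) :* Y :^ 2 :- con (+ 30) :* Y :- con (+ 8)

rhs1≡L₁²+R₁ : ∀ Y → rhs1 Y ≡ ⟦ L₁ ⟧₁ Y * ⟦ L₁ ⟧₁ Y + ⟦ R₁ ⟧₁ Y
rhs1≡L₁²+R₁ = solve 1 (λ Y → Y :^ 4 :- con (+ 8) :* Y :^ 3 :+ con (+ 12) :* Y :^ 2 :- con (+ 6) :* Y :+ con (+ 1)
                            := L₁ Y :* L₁ Y :+ R₁ Y) refl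

noPositiveSolution₁ : NoPositiveSolution rhs1
noPositiveSolution₁ = noPositiveSolution-by-squeeze rhs1 ⟦ L₁ ⟧₁ ⟦ R₁ ⟧₁ 16 rhs1≡L₁²+R₁
  (natural-coefficients⇒positive (R₁ (con (+ 16) :+ var zero)) 24 (34 ∷ 2 ∷ []) λ _ → refl)
  (natural-coefficients⇒positive (upperGap L₁ R₁ (con (+ 16) :+ var zero)) 355 (22 ∷ []) λ _ → refl)
  refl

L₂ R₂ : PolyExpr
L₂ Y = Y :^ 3 :- con (+ 4)
R₂ Y = con (+ 12) :* Y :^ 2 :- con (+ 6) :* Y :- con (+ 15)

rhs2≡L₂²+R₂ : ∀ Y → rhs2 Y ≡ ⟦ L₂ ⟧₁ Y * ⟦ L₂ ⟧₁ Y + ⟦ R₂ ⟧₁ Y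
rhs2≡L₂²+R₂ = solve 1 (λ Y → Y :^ 6 :- con (+ 8) :* Y :^ 3 :+ con (+ 12) :* Y :^ 2 :- con (+ 6) :* Y :+ con (+ 1)
                            := L₂ Y :* L₂ Y :+ R₂ Y) refl

noPositiveSolution₂ : NoPositiveSolution rhs2
noPositiveSolution₂ = noPositiveSolution-by-squeeze rhs2 ⟦ L₂ ⟧₁ ⟦ R₂ ⟧₁ 6 rhs2≡L₂²+R₂
  (natural-coefficients⇒positive (R₂ (con (+ 6) :+ var zero)) 381 (138 ∷ 12 ∷ []) λ _ → refl)
  (natural-coefficients⇒positive (upperGap L₂ R₂ (con (+ 6) :+ var zero)) 44 (78 ∷ 24 ∷ 2 ∷ []) λ _ → refl)
  refl

L₃ R₃ : PolyExpr
L₃ Y = Y :^ 3 :- con (+ 16) :* Y :^ 2 :- con (+ 88) :* Y :- con (+ 1449)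
R₃ Y = con (+ 2) :* Y :^ 3 :- con (+ 54072) :* Y :^ 2 :- con (+ 255034) :* Y :- con (+ 2099600)

rhs3≡L₃²+R₃ : ∀ Y → rhs3 Y ≡ ⟦ L₃ ⟧₁ Y * ⟦ L₃ ⟧₁ Y + ⟦ R₃ ⟧₁ Y
rhs3≡L₃²+R₃ = solve 1 (λ Y → Y :^ 6 :- con (+ 32) :* Y :^ 5 :+ con (+ 80) :* Y :^ 4 :- con (+ 80) :* Y :^ 3
                              :+ con (+ 40) :* Y :^ 2 :- con (+ 10) :* Y :+ con (+ 1)
                            := L₃ Y :* L₃ Y :+ R₃ Y) refl

noPositiveSolution₃ : NoPositiveSolution rhs3
noPositiveSolution₃ = noPositiveSolution-by-squeeze rhs3 ⟦ L₃ ⟧₁ ⟦ R₃ ⟧₁ 27041 rhs3≡L₃²+R₃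
  (natural-coefficients⇒positive (R₃ (con (+ 27041) :+ var zero)) 413682816
     (1462717148 ∷ 108174 ∷ 2 ∷ []) λ _ → refl)
  (natural-coefficients⇒positive (upperGap L₃ R₃ (con (+ 27041) :+ var zero)) 39521789113121
     (2922846138 ∷ 54040 ∷ []) λ _ → refl)
  refl

L₄ R₄ : PolyExpr
L₄ Y = Y :^ 4 :- con (+ 16) :* Y :+ con (+ 39)
R₄ Y = con (+ 2) :* Y :^ 4 :- con (+ 80) :* Y :^ 3 :- con (+ 216) :* Y :^ 2 :+ con (+ 1238) :* Y :- con (+ 1520)

rhs4≡L₄²+R₄ : ∀ Y → rhs4 Y ≡ ⟦ L₄ ⟧₁ Y * ⟦ L₄ ⟧₁ Y + ⟦ R₄ ⟧₁ Y
rhs4≡L₄²+R₄ = solve 1 (λ Y → Y :^ 8 :- con (+ 32) :* Y :^ 5 :+ con (+ 80) :* Y :^ 4 :- con (+ 80) :* Y :^ 3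
                              :+ con (+ 40) :* Y :^ 2 :- con (+ 10) :* Y :+ con (+ 1)
                            := L₄ Y :* L₄ Y :+ R₄ Y) refl

noPositiveSolution₄ : NoPositiveSolution rhs4
noPositiveSolution₄ = noPositiveSolution-by-squeeze rhs4 ⟦ L₄ ⟧₁ ⟦ R₄ ⟧₁ 43 rhs4≡L₄²+R₄
  (natural-coefficients⇒positive (R₄ (con (+ 43) :+ var zero)) 129372
     (174958 ∷ 11652 ∷ 264 ∷ 2 ∷ []) λ _ → refl)
  (natural-coefficients⇒positive (upperGap L₄ R₄ (con (+ 43) :+ var zero)) 6706933
     (461066 ∷ 10536 ∷ 80 ∷ []) λ _ → refl)
  refl

L₅ R₅ : PolyExpr
L₅ Y = Y :^ 5 :- con (+ 4) :* Y
R₅ Y = con (+ 12) :* Y :^ 4 :- con (+ 22) :* Y :^ 2 :+ con (+ 1)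

rhs5≡L₅²+R₅ : ∀ Y → rhs5 Y ≡ ⟦ L₅ ⟧₁ Y * ⟦ L₅ ⟧₁ Y + ⟦ R₅ ⟧₁ Y
rhs5≡L₅²+R₅ = solve 1 (λ Y → Y :^ 10 :- con (+ 8) :* Y :^ 6 :+ con (+ 12) :* Y :^ 4 :- con (+ 6) :* Y :^ 2 :+ con (+ 1)
                            := L₅ Y :* L₅ Y :+ R₅ Y) refl

noPositiveSolution₅ : NoPositiveSolution rhs5
noPositiveSolution₅ = noPositiveSolution-by-squeeze rhs5 ⟦ L₅ ⟧₁ ⟦ R₅ ⟧₁ 6 rhs5≡L₅²+R₅
  (natural-coefficients⇒positive (R₅ (con (+ 6) :+ var zero)) 14761
     (10104 ∷ 2570 ∷ 288 ∷ 12 ∷ []) λ _ → refl)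
  (natural-coefficients⇒positive (upperGap L₅ R₅ (con (+ 6) :+ var zero)) 744
     (2848 ∷ 1750 ∷ 432 ∷ 48 ∷ 2 ∷ []) λ _ → refl)
  refl

L₆ R₆ : PolyExpr
L₆ Y = Y :^ 5 :- con (+ 16)
R₆ Y = con (+ 80) :* Y :^ 4 :- con (+ 80) :* Y :^ 3 :+ con (+ 40) :* Y :^ 2 :- con (+ 10) :* Y :- con (+ 255)

rhs6≡L₆²+R₆ : ∀ Y → rhs6 Y ≡ ⟦ L₆ ⟧₁ Y * ⟦ L₆ ⟧₁ Y + ⟦ R₆ ⟧₁ Y
rhs6≡L₆²+R₆ = solve 1 (λ Y → Y :^ 10 :- con (+ 32) :* Y :^ 5 :+ con (+ 80) :* Y :^ 4 :- con (+ 80) :* Y :^ 3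
                              :+ con (+ 40) :* Y :^ 2 :- con (+ 10) :* Y :+ con (+ 1)
                            := L₆ Y :* L₆ Y :+ R₆ Y) refl

noPositiveSolution₆ : NoPositiveSolution rhs6
noPositiveSolution₆ = noPositiveSolution-by-squeeze rhs6 ⟦ L₆ ⟧₁ ⟦ R₆ ⟧₁ 39 rhs6≡L₆²+R₆
  (natural-coefficients⇒positive (R₆ (con (+ 39) :+ var zero)) 180389955
     (18620150 ∷ 720760 ∷ 12400 ∷ 80 ∷ []) λ _ → refl)
  (natural-coefficients⇒positive (upperGap L₆ R₆ (con (+ 39) :+ var zero)) 58412
     (4514260 ∷ 465620 ∷ 18020 ∷ 310 ∷ 2 ∷ []) λ _ → refl)
  refl

L₇ R₇ : PolyExpr
L₇ Y = Y :^ 7 :- con (+ 16) :* Y :^ 3 :+ con (+ 40) :* Y :- con (+ 1)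
R₇ Y = con (+ 2) :* Y :^ 7 :- con (+ 336) :* Y :^ 6 :+ con (+ 1320) :* Y :^ 4 :- con (+ 32) :* Y :^ 3
       :- con (+ 1610) :* Y :^ 2 :+ con (+ 80) :* Y

-- Normalising Y ^ 14 is too expensive for the solver, so it works with A = Y ^ 7 (and Y ^ 9 below).
rhs7≡L₇²+R₇ : ∀ Y → rhs7 Y ≡ ⟦ L₇ ⟧₁ Y * ⟦ L₇ ⟧₁ Y + ⟦ R₇ ⟧₁ Y
rhs7≡L₇²+R₇ Y = trans
  (cong₂ (λ Y¹⁴ Y¹⁰ → Y¹⁴ - + 32 * Y¹⁰ + + 80 * Y ^ 8 - + 80 * Y ^ 6 + + 40 * Y ^ 4 - + 10 * Y ^ 2 + + 1)
         (ℤ.^-distribˡ-+-* Y 7 7) (ℤ.^-distribˡ-+-* Y 3 7))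
  (solve 2 (λ Y A → A :* A :- con (+ 32) :* (Y :^ 3 :* A) :+ con (+ 80) :* (Y :* A) :- con (+ 80) :* Y :^ 6
                    :+ con (+ 40) :* Y :^ 4 :- con (+ 10) :* Y :^ 2 :+ con (+ 1)
                  := (A :- con (+ 16) :* Y :^ 3 :+ con (+ 40) :* Y :- con (+ 1))
                     :* (A :- con (+ 16) :* Y :^ 3 :+ con (+ 40) :* Y :- con (+ 1))
                     :+ (con (+ 2) :* A :- con (+ 336) :* Y :^ 6 :+ con (+ 1320) :* Y :^ 4 :- con (+ 32) :* Y :^ 3
                         :- con (+ 1610) :* Y :^ 2 :+ con (+ 80) :* Y))
         refl Y (Y ^ 7))

noPositiveSolution₇ : NoPositiveSolution rhs7
noPositiveSolution₇ = noPositiveSolution-by-squeeze rhs7 ⟦ L₇ ⟧₁ ⟦ R₇ ⟧₁ 168 rhs7≡L₇²+R₇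
  (natural-coefficients⇒positive (R₇ (con (+ 168) :+ var zero)) 1051307152896
     (44991180613424 ∷ 1606157375158 ∷ 23898712288 ∷ 189666600 ∷ 846720 ∷ 2016 ∷ 2 ∷ []) λ _ → refl)
  (natural-coefficients⇒positive (upperGap L₇ R₇ (con (+ 168) :+ var zero)) 7553261412998783
     (269771853005088 ∷ 4014611114570 ∷ 31862880000 ∷ 142247640 ∷ 338688 ∷ 336 ∷ []) λ _ → refl)
  refl

L₈ R₈ : PolyExpr
L₈ Y = Y :^ 9 :- con (+ 16) :* Y
R₈ Y = con (+ 80) :* Y :^ 8 :- con (+ 80) :* Y :^ 6 :+ con (+ 40) :* Y :^ 4 :- con (+ 266) :* Y :^ 2 :+ con (+ 1)

rhs8≡L₈²+R₈ : ∀ Y → rhs8 Y ≡ ⟦ L₈ ⟧₁ Y * ⟦ L₈ ⟧₁ Y + ⟦ R₈ ⟧₁ Y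
rhs8≡L₈²+R₈ Y = trans
  (cong (λ Y¹⁸ → Y¹⁸ - + 32 * Y ^ 10 + + 80 * Y ^ 8 - + 80 * Y ^ 6 + + 40 * Y ^ 4 - + 10 * Y ^ 2 + + 1)
        (ℤ.^-distribˡ-+-* Y 9 9))
  (solve 2 (λ Y A → A :* A :- con (+ 32) :* (Y :* A) :+ con (+ 80) :* Y :^ 8 :- con (+ 80) :* Y :^ 6
                    :+ con (+ 40) :* Y :^ 4 :- con (+ 10) :* Y :^ 2 :+ con (+ 1)
                  := (A :- con (+ 16) :* Y) :* (A :- con (+ 16) :* Y) :+ R₈ Y)
         refl Y (Y ^ 9))

noPositiveSolution₈ : NoPositiveSolution rhs8
noPositiveSolution₈ = noPositiveSolution-by-squeeze rhs8 ⟦ L₈ ⟧₁ ⟦ R₈ ⟧₁ 40 rhs8≡L₈²+R₈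
  (natural-coefficients⇒positive (R₈ (con (+ 40) :+ var zero)) 523960421974401
     (104808458218720 ∷ 9171968383734 ∷ 458649606400 ∷ 14334080040 ∷ 286700800 ∷ 3583920 ∷ 25600 ∷ 80 ∷ [])
     λ _ → refl)
  (natural-coefficients⇒positive (upperGap L₈ R₈ (con (+ 40) :+ var zero)) 327578024320
     (13156341781248 ∷ 2624511616266 ∷ 229478393600 ∷ 11470719960 ∷ 358419200 ∷ 7168080 ∷ 89600 ∷ 640 ∷ 2 ∷ [])
     λ _ → refl)
  refl

lemma2p3 : NoPositiveSolution rhs1 × NoPositiveSolution rhs2 × NoPositiveSolution rhs3
         × NoPositiveSolution rhs4 × NoPositiveSolution rhs5 × NoPositiveSolution rhs6
         × NoPositiveSolution rhs7 × NoPositiveSolution rhs8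
lemma2p3 = noPositiveSolution₁ , noPositiveSolution₂ , noPositiveSolution₃ , noPositiveSolution₄
         , noPositiveSolution₅ , noPositiveSolution₆ , noPositiveSolution₇ , noPositiveSolution₈
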